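{- Let $n\ge 2$ and let $p$ be chosen uniformly at random from $S_n$. Then the expected number of distinct $(n-1)$-patterns of $p$ is $\mathbb{E}(|D_1(p)|) = n-\frac{2(n-1)}{n}$.
   Context: For $p\in S_n$ (one-line notation), $D_1(p)$ is the set of permutations in $S_{n-1}$ obtainable from $p$ by deleting one entry and relabelling the remaining entries $1$ through $n-1$ preserving relative order. -}

module Defs where

open import Data.Nat using (ℕ; zero; suc; _<ᵇ_; _∸_; _≟_)
open import Data.Bool using (if_then_else_)
open import Data.Fin using (Fin)
open import Data.List using (List; []; _∷_; length; map; concatMap; allFin; insertAt; removeAt; lookup; deduplicate)
open import Data.Nat.ListAction using (sum)
open import Data.Nat using (_≥_; NonZero; ≢-nonZero)
open import Data.Nat.Properties using (m≤n⇒m≤1+n)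
open import Data.Integer as ℤ using (+_)
open import Data.Rational using (ℚ; _/_; _-_; _*_)
open import Relation.Binary.PropositionalEquality using (_≡_)
open import Data.List.Properties using (≡-dec)

-- Permutations are in one-line notation: a list [p 1, ..., p n] of the values 1..n.

insertions : ℕ → List ℕ → List (List ℕ)
insertions x xs = map (λ i → insertAt xs i x) (allFin _)

S : ℕ → List (List ℕ)
S zero    = [] ∷ []
S (suc n) = concatMap (insertions (suc n)) (S n)

deleteEntry : (p : List ℕ) → Fin (length p) → List ℕ
deleteEntry p i = map (λ y → if v <ᵇ y then y ∸ 1 else y) (removeAt p i)
  where v = lookup p i

D₁ : List ℕ → List (List ℕ)
D₁ p = deduplicate (≡-dec _≟_) (map (deleteEntry p) (allFin (length p)))

totalD₁ : ℕ → ℕ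
totalD₁ n = sum (map (λ p → length (D₁ p)) (S n))

nonZero≥2 : ∀ {n} → n ≥ 2 → NonZero n
nonZero≥2 {suc n} _ = _

rhs : (n : ℕ) → n ≥ 2 → ℚ
rhs n h = (+ n) / 1 - ((+ 2 ℤ.* (+ n ℤ.- + 1)) / n) {{nonZero≥2 h}}

module Submission where

-- Deleting two neighbouring entries of p gives the same pattern exactly when they hold consecutive
-- values, and equal patterns arise in no other way; hence |D₁(p)| = n − b(p), where the bonds b(p)
-- count the adjacent positions of p holding consecutive values. Inserting n + 1 into each of the
-- n + 1 gaps of a permutation q of length n keeps every bond of q in n of the insertions and makes
-- n + 1 bond with n in exactly two of them, so Σ_{S_{n+1}} b = n Σ_{S_n} b + 2 n!, that is
-- Σ_{S_n} b = 2(n − 1)(n − 1)!, and the expectation is n − 2(n − 1)/n.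

open import Defs
open import Algebra.Properties.CommutativeSemigroup using (interchange)
open import Data.Bool using (if_then_else_)
open import Data.Fin using (Fin; zero; suc; toℕ; inject₁)
open import Data.Integer as ℤ using ()
open import Data.Integer.Properties using (pos-*)
import Data.Integer.Tactic.RingSolver as ℤ-Solver
open import Data.List using (List; []; _∷_; _++_; length; map; filter; tabulate; lookup; insertAt; allFin; concatMap; deduplicate)
open import Data.List.Membership.Propositional using (_∈_; _∉_)
open import Data.List.Membership.Propositional.Properties using (∈-tabulate⁻; ∈-lookup)
open import Data.List.Properties
  using (≡-dec; map-tabulate; filter-accept; filter-reject; filter-all; ∷-injective; length-insertAt; map-++; length-++; length-map; length-tabulate)
open import Data.List.Relation.Binary.Permutation.Propositional as ↭ using (_↭_; ↭-sym; ↭⇒↭ₛ)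
open import Data.List.Relation.Binary.Permutation.Propositional.Properties using (All-resp-↭; Any-resp-↭)
import Data.List.Relation.Unary.All as All
open import Data.List.Relation.Unary.All using (All; []; _∷_)
open import Data.List.Relation.Unary.All.Properties using (¬Any⇒All¬; concat⁺; map⁺; tabulate⁺)
open import Data.List.Relation.Unary.AllPairs using ([]; _∷_)
open import Data.List.Relation.Unary.Any using (here; there)
import Data.List.Relation.Unary.Any.Properties as Any
open import Data.List.Relation.Unary.Unique.Propositional using (Unique)
open import Data.List.Relation.Unary.Unique.Propositional.Properties using (Unique[x∷xs]⇒x∉xs)
import Data.List.Relation.Unary.Unique.DecPropositional.Properties as UniqueDec
open import Data.Nat using (ℕ; zero; suc; pred; _+_; _*_; _∸_; _≤_; _<_; _≥_; _≟_; _<?_; z≤n; s≤s)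
open import Data.Nat.ListAction using (sum)
open import Data.Nat.ListAction.Properties using (sum-++)
open import Data.Nat.Properties hiding (_≟_)
open import Data.Nat.Tactic.RingSolver using (solve-∀)
open import Data.Product using (_,_; _×_; proj₁; proj₂)
open import Data.Rational as ℚ using (_/_; toℚᵘ)
open import Data.Rational.Properties using (toℚᵘ-injective; toℚᵘ-fromℚᵘ; toℚᵘ-homo-*; toℚᵘ-homo-+; toℚᵘ-homo‿-)
open import Data.Rational.Unnormalised as ℚᵘ using (mkℚᵘ; *≡*)
open import Data.Rational.Unnormalised.Properties using (*-cong; *-congˡ; +-cong; +-congʳ; -‿cong; module ≃-Reasoning)
open import Data.Sum using (_⊎_; inj₁; inj₂; swap)
open import Function using (_∘_; id; _⇔_; mk⇔; case_of_)
open import Level using (0ℓ)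
open import Relation.Binary.Definitions using (DecidableEquality; tri<; tri≈; tri>)
open import Relation.Binary.PropositionalEquality
open import Data.List.Relation.Binary.Permutation.Setoid.Properties (setoid ℕ) using (Unique-resp-↭)
open import Relation.Nullary using (¬_; Dec; yes; no; does; ¬?; contradiction)
open import Relation.Nullary.Decidable using (_⊎-dec_; does-⇔; dec-true; dec-false)
open import Relation.Unary using (Pred; Decidable)

indicator : ∀ {P : Set} → Dec P → ℕ
indicator P? = if does P? then 1 else 0

indicator-yes : ∀ {P : Set} (P? : Dec P) → P → indicator P? ≡ 1
indicator-yes P? p = cong (λ b → if b then 1 else 0) (dec-true P? p)

indicator-no : ∀ {P : Set} (P? : Dec P) → ¬ P → indicator P? ≡ 0
indicator-no P? ¬p = cong (λ b → if b then 1 else 0) (dec-false P? ¬p)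

indicator-⇔ : ∀ {P Q : Set} → P ⇔ Q → (P? : Dec P) (Q? : Dec Q) → indicator P? ≡ indicator Q?
indicator-⇔ P⇔Q P? Q? = cong (λ b → if b then 1 else 0) (does-⇔ P⇔Q P? Q?)

count : ∀ {A : Set} {P : Pred A 0ℓ} → Decidable P → List A → ℕ
count P? []       = 0
count P? (x ∷ xs) = indicator (P? x) + count P? xs

countFin : ∀ {m} {P : Pred (Fin m) 0ℓ} → Decidable P → ℕ
countFin {zero}  P? = 0
countFin {suc m} P? = indicator (P? zero) + countFin (P? ∘ suc)

countFin-cong : ∀ {m} {P Q : Pred (Fin m) 0ℓ} (P? : Decidable P) (Q? : Decidable Q) →
                (∀ i → P i ⇔ Q i) → countFin P? ≡ countFin Q?
countFin-cong {zero}  P? Q? P⇔Q = refl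
countFin-cong {suc m} P? Q? P⇔Q =
  cong₂ _+_ (indicator-⇔ (P⇔Q zero) (P? zero) (Q? zero)) (countFin-cong (P? ∘ suc) (Q? ∘ suc) (P⇔Q ∘ suc))

sum-tabulate-+ : ∀ {m} (f g : Fin m → ℕ) →
  sum (tabulate (λ i → f i + g i)) ≡ sum (tabulate f) + sum (tabulate g)
sum-tabulate-+ {zero}  f g = refl
sum-tabulate-+ {suc m} f g = trans (cong (f zero + g zero +_) (sum-tabulate-+ (f ∘ suc) (g ∘ suc)))
                                   (interchange +-commutativeSemigroup (f zero) (g zero) _ _)

sum-tabulate-const : ∀ m c → sum (tabulate {n = m} (λ _ → c)) ≡ m * c
sum-tabulate-const zero    c = refl
sum-tabulate-const (suc m) c = cong (c +_) (sum-tabulate-const m c)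

module _ {A : Set} where

  sum-map-cong : ∀ {f g : A → ℕ} {xs} → All (λ x → f x ≡ g x) xs → sum (map f xs) ≡ sum (map g xs)
  sum-map-cong []           = refl
  sum-map-cong (fx≡gx ∷ eq) = cong₂ _+_ fx≡gx (sum-map-cong eq)

  sum-map-+ : ∀ (f g : A → ℕ) xs → sum (map (λ x → f x + g x) xs) ≡ sum (map f xs) + sum (map g xs)
  sum-map-+ f g []       = refl
  sum-map-+ f g (x ∷ xs) =
    trans (cong (f x + g x +_) (sum-map-+ f g xs)) (interchange +-commutativeSemigroup (f x) (g x) _ _)

  sum-map-const : ∀ c (xs : List A) → sum (map (λ _ → c) xs) ≡ c * length xs
  sum-map-const c []       = sym (*-zeroʳ c)
  sum-map-const c (x ∷ xs) = trans (cong (c +_) (sum-map-const c xs)) (sym (*-suc c (length xs)))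

  sum-map-affine : ∀ a b (f : A → ℕ) xs → sum (map (λ x → a * f x + b) xs) ≡ a * sum (map f xs) + b * length xs
  sum-map-affine a b f []       = sym (cong₂ _+_ (*-zeroʳ a) (*-zeroʳ b))
  sum-map-affine a b f (x ∷ xs) = trans (cong (a * f x + b +_) (sum-map-affine a b f xs)) (regroup a b (f x) _ _)
    where
    regroup : ∀ a b u v l → (a * u + b) + (a * v + b * l) ≡ a * (u + v) + b * suc l
    regroup = solve-∀

  module _ {B : Set} (g : A → List B) where

    sum-map-concatMap : ∀ (f : B → ℕ) xs → sum (map f (concatMap g xs)) ≡ sum (map (λ x → sum (map f (g x))) xs)
    sum-map-concatMap f []       = refl
    sum-map-concatMap f (x ∷ xs) = begin
      sum (map f (g x ++ concatMap g xs))               ≡⟨ cong sum (map-++ f (g x) (concatMap g xs)) ⟩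
      sum (map f (g x) ++ map f (concatMap g xs))       ≡⟨ sum-++ (map f (g x)) _ ⟩
      sum (map f (g x)) + sum (map f (concatMap g xs))  ≡⟨ cong (sum (map f (g x)) +_) (sum-map-concatMap f xs) ⟩
      sum (map f (g x)) + sum (map (λ x → sum (map f (g x))) xs) ∎
      where open ≡-Reasoning

    length-concatMap : ∀ xs → length (concatMap g xs) ≡ sum (map (length ∘ g) xs)
    length-concatMap []       = refl
    length-concatMap (x ∷ xs) = trans (length-++ (g x)) (cong (length (g x) +_) (length-concatMap xs))

module _ {A : Set} (_≟ᴬ_ : DecidableEquality A) where

  open UniqueDec _≟ᴬ_ using (deduplicate-!)

  length-filter-≢ : ∀ {x ys} → Unique ys → x ∈ ys → suc (length (filter (¬? ∘ (x ≟ᴬ_)) ys)) ≡ length ys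
  length-filter-≢ {x} (x≢ys ∷ _) (here refl) = cong (suc ∘ length)
    (trans (filter-reject (¬? ∘ (x ≟ᴬ_)) (λ x≢x → x≢x refl)) (filter-all (¬? ∘ (x ≟ᴬ_)) x≢ys))
  length-filter-≢ {x} {y ∷ ys} !y∷ys@(_ ∷ !ys) (there x∈ys) =
    trans (cong (suc ∘ length) (filter-accept (¬? ∘ (x ≟ᴬ_)) x≢y)) (cong suc (length-filter-≢ !ys x∈ys))
    where
    x≢y : x ≢ y
    x≢y refl = Unique[x∷xs]⇒x∉xs !y∷ys x∈ys

  length-deduplicate-∷-∈ : ∀ {x xs} → x ∈ xs →
    length (deduplicate _≟ᴬ_ (x ∷ xs)) ≡ length (deduplicate _≟ᴬ_ xs)
  length-deduplicate-∷-∈ {x} {xs} x∈xs =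
    length-filter-≢ (deduplicate-! xs) (Any.deduplicate⁺ _≟ᴬ_ (λ y≡z x≡z → trans x≡z (sym y≡z)) x∈xs)

  length-deduplicate-∷-∉ : ∀ {x xs} → x ∉ xs →
    length (deduplicate _≟ᴬ_ (x ∷ xs)) ≡ suc (length (deduplicate _≟ᴬ_ xs))
  length-deduplicate-∷-∉ {x} x∉xs =
    cong (suc ∘ length) (filter-all (¬? ∘ (x ≟ᴬ_)) (¬Any⇒All¬ _ (x∉xs ∘ Any.deduplicate⁻ _≟ᴬ_)))

  length-deduplicate-∷ : ∀ {x y ys} → (x ∈ y ∷ ys → x ≡ y) →
    length (deduplicate _≟ᴬ_ (x ∷ y ∷ ys)) + indicator (x ≟ᴬ y) ≡ suc (length (deduplicate _≟ᴬ_ (y ∷ ys)))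
  length-deduplicate-∷ {x} {y} {ys} x∈⇒x≡y = case x ≟ᴬ y of λ where
    (yes x≡y) → trans (cong₂ _+_ (length-deduplicate-∷-∈ {xs = y ∷ ys} (here x≡y)) (indicator-yes (x ≟ᴬ y) x≡y))
                      (+-comm (length (deduplicate _≟ᴬ_ (y ∷ ys))) 1)
    (no x≢y)  → trans (cong₂ _+_ (length-deduplicate-∷-∉ (x≢y ∘ x∈⇒x≡y)) (indicator-no (x ≟ᴬ y) x≢y))
                      (+-identityʳ _)

  IntervalFibres : ∀ {m} → (Fin (suc m) → A) → Set
  IntervalFibres {m} f =
    ∀ (i k : Fin m) → toℕ i ≤ toℕ k → f (inject₁ i) ≡ f (suc k) → f (inject₁ i) ≡ f (suc i)

  length-deduplicate-tabulate : ∀ {m} (f : Fin (suc m) → A) → IntervalFibres f →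
    length (deduplicate _≟ᴬ_ (tabulate f)) + countFin (λ i → f (inject₁ i) ≟ᴬ f (suc i)) ≡ suc m
  length-deduplicate-tabulate {zero}  f _      = refl
  length-deduplicate-tabulate {suc m} f fibres = begin
    distinct f + (first-repeat + repeats)   ≡⟨ +-assoc (distinct f) first-repeat repeats ⟨
    distinct f + first-repeat + repeats     ≡⟨ cong (_+ repeats) (length-deduplicate-∷ head∈tail⇒repeat) ⟩
    suc (distinct (f ∘ suc) + repeats)      ≡⟨ cong suc (length-deduplicate-tabulate (f ∘ suc) fibres-suc) ⟩
    suc (suc m) ∎
    where
    open ≡-Reasoning
    distinct : ∀ {k} → (Fin k → A) → ℕ
    distinct g = length (deduplicate _≟ᴬ_ (tabulate g))
    first-repeat = indicator (f zero ≟ᴬ f (suc zero))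
    repeats = countFin (λ i → f (suc (inject₁ i)) ≟ᴬ f (suc (suc i)))
    fibres-suc : IntervalFibres (f ∘ suc)
    fibres-suc i k i≤k = fibres (suc i) (suc k) (s≤s i≤k)
    head∈tail⇒repeat : f zero ∈ tabulate (f ∘ suc) → f zero ≡ f (suc zero)
    head∈tail⇒repeat f₀∈ with ∈-tabulate⁻ f₀∈
    ... | k , f₀≡fₖ₊₁ = fibres zero k z≤n f₀≡fₖ₊₁

ℕ-sum⇒ℤ-difference : ∀ (t f b c d : ℕ) → t * d + f * c ≡ f * b * d →
  ℤ.+ t ℤ.* ℤ.+ d ≡ ℤ.+ f ℤ.* (ℤ.+ b ℤ.* ℤ.+ d ℤ.- ℤ.+ c)
ℕ-sum⇒ℤ-difference t f b c d h = begin
  T ℤ.* D                             ≡⟨ isolate (T ℤ.* D) (F ℤ.* C) ⟩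
  (T ℤ.* D ℤ.+ F ℤ.* C) ℤ.- F ℤ.* C   ≡⟨ cong (ℤ._- F ℤ.* C) lifted ⟩
  F ℤ.* B ℤ.* D ℤ.- F ℤ.* C           ≡⟨ factor F B D C ⟩
  F ℤ.* (B ℤ.* D ℤ.- C) ∎
  where
  open ≡-Reasoning
  T = ℤ.+ t ; F = ℤ.+ f ; B = ℤ.+ b ; C = ℤ.+ c ; D = ℤ.+ d
  lifted : T ℤ.* D ℤ.+ F ℤ.* C ≡ F ℤ.* B ℤ.* D
  lifted = begin
    T ℤ.* D ℤ.+ F ℤ.* C      ≡⟨ cong₂ ℤ._+_ (pos-* t d) (pos-* f c) ⟨
    ℤ.+ (t * d + f * c)      ≡⟨ cong ℤ.+_ h ⟩
    ℤ.+ (f * b * d)          ≡⟨ trans (pos-* (f * b) d) (cong (ℤ._* D) (pos-* f b)) ⟩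
    F ℤ.* B ℤ.* D ∎
  isolate : ∀ x y → x ≡ (x ℤ.+ y) ℤ.- y
  isolate = ℤ-Solver.solve-∀
  factor : ∀ F B D C → F ℤ.* B ℤ.* D ℤ.- F ℤ.* C ≡ F ℤ.* (B ℤ.* D ℤ.- C)
  factor = ℤ-Solver.solve-∀

cleared-denominator⇒≡ : ∀ (t f b c d : ℕ) → t * suc d + f * c ≡ f * b * suc d →
  (ℤ.+ t) / 1 ≡ ((ℤ.+ f) / 1) ℚ.* ((ℤ.+ b) / 1 ℚ.- (ℤ.+ c) / suc d)
cleared-denominator⇒≡ t f b c d h = toℚᵘ-injective (begin
  toℚᵘ (T / 1)
    ≈⟨ toℚᵘ-fromℚᵘ (mkℚᵘ T 0) ⟩
  mkℚᵘ T 0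
    ≈⟨ *≡* cross-multiplied ⟩
  mkℚᵘ F 0 ℚᵘ.* (mkℚᵘ B 0 ℚᵘ.- mkℚᵘ C d)
    ≈⟨ *-cong (toℚᵘ-fromℚᵘ (mkℚᵘ F 0)) (+-cong (toℚᵘ-fromℚᵘ (mkℚᵘ B 0)) (-‿cong (toℚᵘ-fromℚᵘ (mkℚᵘ C d)))) ⟨
  toℚᵘ (F / 1) ℚᵘ.* (toℚᵘ (B / 1) ℚᵘ.- toℚᵘ (C / suc d))
    ≈⟨ *-congˡ {toℚᵘ (F / 1)} (+-congʳ (toℚᵘ (B / 1)) (toℚᵘ-homo‿- (C / suc d))) ⟨
  toℚᵘ (F / 1) ℚᵘ.* (toℚᵘ (B / 1) ℚᵘ.+ toℚᵘ (ℚ.- (C / suc d)))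
    ≈⟨ *-congˡ {toℚᵘ (F / 1)} (toℚᵘ-homo-+ (B / 1) (ℚ.- (C / suc d))) ⟨
  toℚᵘ (F / 1) ℚᵘ.* toℚᵘ (B / 1 ℚ.- C / suc d)
    ≈⟨ toℚᵘ-homo-* (F / 1) (B / 1 ℚ.- C / suc d) ⟨
  toℚᵘ ((F / 1) ℚ.* (B / 1 ℚ.- C / suc d)) ∎)
  where
  open ≃-Reasoning
  T = ℤ.+ t ; F = ℤ.+ f ; B = ℤ.+ b ; C = ℤ.+ c ; D = ℤ.+ suc d
  -- *≡* wants the cross-multiplied equation in exactly the form ℚᵘ's _*_, _+_ and -_ compute to
  cross-multiplied : T ℤ.* ℤ.+ (1 * (1 * suc d)) ≡ (F ℤ.* (B ℤ.* D ℤ.+ ℤ.- C ℤ.* ℤ.+ 1)) ℤ.* ℤ.+ 1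
  cross-multiplied = trans (cong (λ n → T ℤ.* ℤ.+ n) (trans (*-identityˡ _) (*-identityˡ _)))
                           (trans (ℕ-sum⇒ℤ-difference t f b c (suc d) h) (ℚᵘ-shape F B D C))
    where
    ℚᵘ-shape : ∀ F B D C → F ℤ.* (B ℤ.* D ℤ.- C) ≡ (F ℤ.* (B ℤ.* D ℤ.+ ℤ.- C ℤ.* ℤ.+ 1)) ℤ.* ℤ.+ 1
    ℚᵘ-shape = ℤ-Solver.solve-∀

-- deleteEntry p i unfolds to map (relabel (lookup p i)) (removeAt p i).
relabel : ℕ → ℕ → ℕ
relabel v y = if does (v <? y) then y ∸ 1 else y

relabel-< : ∀ {v y} → v < y → suc (relabel v y) ≡ y
relabel-< {v} {suc y} v<y = cong (λ b → suc (if b then y else suc y)) (dec-true (v <? suc y) v<y)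

relabel-≮ : ∀ {v y} → ¬ v < y → relabel v y ≡ y
relabel-≮ {v} {y} v≮y = cong (λ b → if b then y ∸ 1 else y) (dec-false (v <? y) v≮y)

Consecutive : ℕ → ℕ → Set
Consecutive a b = suc a ≡ b ⊎ suc b ≡ a

consecutive? : ∀ a b → Dec (Consecutive a b)
consecutive? a b = (suc a ≟ b) ⊎-dec (suc b ≟ a)

indicator-consecutive-sym : ∀ a b → indicator (consecutive? a b) ≡ indicator (consecutive? b a)
indicator-consecutive-sym a b = indicator-⇔ (mk⇔ swap swap) (consecutive? a b) (consecutive? b a)

relabel-suc : ∀ {a z} → z ≢ suc a → relabel a z ≡ relabel (suc a) z
relabel-suc {a} {z} z≢1+a with a <? z
... | yes a<z = cong pred (trans (relabel-< a<z) (sym (relabel-< (≤∧≢⇒< a<z (z≢1+a ∘ sym)))))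
... | no a≮z = trans (relabel-≮ a≮z) (sym (relabel-≮ (a≮z ∘ <-trans (n<1+n a))))

relabel-consecutive : ∀ {a b z} → Consecutive a b → a ≢ z → b ≢ z → relabel a z ≡ relabel b z
relabel-consecutive (inj₁ refl) _ b≢z = relabel-suc (b≢z ∘ sym)
relabel-consecutive (inj₂ refl) a≢z _ = sym (relabel-suc (a≢z ∘ sym))

relabel-swap : ∀ {a b} → Consecutive a b → relabel a b ≡ relabel b a
relabel-swap {a}     (inj₁ refl) = trans (cong pred (relabel-< (n<1+n a))) (sym (relabel-≮ (n≮n a ∘ <-trans (n<1+n a))))
relabel-swap {_} {b} (inj₂ refl) = trans (relabel-≮ (n≮n b ∘ <-trans (n<1+n b))) (cong pred (sym (relabel-< (n<1+n b))))

-- relabel a b is b or b ∸ 1 and relabel c a is a or a ∸ 1 (the latter only when 0 < a, as c < a);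
-- for a ≢ b these agree only when b = a + 1 or a = b + 1.
relabel-≡⇒consecutive : ∀ {a b c} → a ≢ b → relabel a b ≡ relabel c a → Consecutive a b
relabel-≡⇒consecutive {a} {b} {c} a≢b eq with <-cmp a b | c <? a
... | tri≈ _ a≡b _ | _       = contradiction a≡b a≢b
... | tri< a<b _ _ | yes c<a = contradiction (trans (sym (relabel-< c<a)) (trans (cong suc (sym eq)) (relabel-< a<b))) a≢b
... | tri< a<b _ _ | no c≮a  = inj₁ (trans (cong suc (trans (sym (relabel-≮ c≮a)) (sym eq))) (relabel-< a<b))
... | tri> _ _ b<a | yes c<a = inj₂ (trans (cong suc (trans (sym (relabel-≮ (<-asym b<a))) eq)) (relabel-< c<a))
... | tri> _ _ b<a | no c≮a  = contradiction (trans (sym (relabel-≮ c≮a)) (trans (sym eq) (relabel-≮ (<-asym b<a)))) a≢b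

deleteEntry-consecutive : ∀ {x xs} → Unique (x ∷ xs) → (i : Fin (length xs)) →
  Consecutive (lookup (x ∷ xs) (inject₁ i)) (lookup xs i) →
  deleteEntry (x ∷ xs) (inject₁ i) ≡ deleteEntry (x ∷ xs) (suc i)
deleteEntry-consecutive {x} {y ∷ ys} ((_ ∷ x≢ys) ∷ y≢ys ∷ _) zero xy =
  cong₂ _∷_ (relabel-swap xy) (map-cong-All (All.zip (x≢ys , y≢ys)))
  where
  map-cong-All : ∀ {zs} → All (λ z → x ≢ z × y ≢ z) zs → map (relabel x) zs ≡ map (relabel y) zs
  map-cong-All []                = refl
  map-cong-All ((x≢z , y≢z) ∷ h) = cong₂ _∷_ (relabel-consecutive xy x≢z y≢z) (map-cong-All h)
deleteEntry-consecutive {x} {y ∷ ys} (x≢xs ∷ !xs) (suc i) consec =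
  cong₂ _∷_ (relabel-consecutive consec (≢-sym (x≢lookup (inject₁ i))) (≢-sym (x≢lookup (suc i))))
            (deleteEntry-consecutive !xs i consec)
  where
  x≢lookup : ∀ j → x ≢ lookup (y ∷ ys) j
  x≢lookup j = All.lookup x≢xs (∈-lookup j)

deleteEntry-≡⇒consecutive : ∀ {x xs} → Unique (x ∷ xs) → (i k : Fin (length xs)) → toℕ i ≤ toℕ k →
  deleteEntry (x ∷ xs) (inject₁ i) ≡ deleteEntry (x ∷ xs) (suc k) →
  Consecutive (lookup (x ∷ xs) (inject₁ i)) (lookup xs i)
deleteEntry-≡⇒consecutive {xs = _ ∷ _} ((x≢y ∷ _) ∷ _) zero    k       _         eq =
  relabel-≡⇒consecutive x≢y (proj₁ (∷-injective eq))
deleteEntry-≡⇒consecutive {xs = _ ∷ _} (_ ∷ !xs)       (suc i) (suc k) (s≤s i≤k) eq =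
  deleteEntry-≡⇒consecutive !xs i k i≤k (proj₂ (∷-injective eq))

bondHead : ℕ → List ℕ → ℕ
bondHead x []      = 0
bondHead x (y ∷ _) = indicator (consecutive? x y)

bonds : List ℕ → ℕ
bonds []       = 0
bonds (x ∷ xs) = bondHead x xs + bonds xs

bonds-countFin : ∀ x xs →
  bonds (x ∷ xs) ≡ countFin (λ i → consecutive? (lookup (x ∷ xs) (inject₁ i)) (lookup xs i))
bonds-countFin x []       = refl
bonds-countFin x (y ∷ ys) = cong (indicator (consecutive? x y) +_) (bonds-countFin y ys)

length-D₁+bonds : ∀ {p} → Unique p → length (D₁ p) + bonds p ≡ length p
length-D₁+bonds {[]}     _  = refl
length-D₁+bonds {x ∷ xs} !p = begin
  length (D₁ (x ∷ xs)) + bonds (x ∷ xs)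
    ≡⟨ cong₂ (λ ps b → length (deduplicate _≟ₗ_ ps) + b) (map-tabulate id f) bonds≡repeats ⟩
  length (deduplicate _≟ₗ_ (tabulate f)) + countFin (λ i → f (inject₁ i) ≟ₗ f (suc i))
    ≡⟨ length-deduplicate-tabulate _≟ₗ_ f fibres ⟩
  suc (length xs) ∎
  where
  open ≡-Reasoning
  _≟ₗ_ = ≡-dec _≟_
  f = deleteEntry (x ∷ xs)
  bonds≡repeats : bonds (x ∷ xs) ≡ countFin (λ i → f (inject₁ i) ≟ₗ f (suc i))
  bonds≡repeats = trans (bonds-countFin x xs) (countFin-cong _ _ λ i →
    mk⇔ (deleteEntry-consecutive !p i) (deleteEntry-≡⇒consecutive !p i i ≤-refl))
  fibres : IntervalFibres _≟ₗ_ f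
  fibres i k i≤k eq = deleteEntry-consecutive !p i (deleteEntry-≡⇒consecutive !p i k i≤k eq)

sum-bondHead-insertAt : ∀ x y ys →
  sum (tabulate (λ i → bondHead y (insertAt ys i x))) ≡ indicator (consecutive? y x) + length ys * bondHead y ys
sum-bondHead-insertAt x y []       = refl
sum-bondHead-insertAt x y (z ∷ zs) = cong (indicator (consecutive? y x) +_) (sum-tabulate-const (suc (length zs)) _)

-- Each bond of q survives in every insertion except the one splitting it, and x bonds with each entry
-- consecutive to it in exactly the two insertions next to that entry.
sum-bonds-insertAt : ∀ x q →
  sum (tabulate (λ i → bonds (insertAt q i x))) ≡ length q * bonds q + 2 * count (consecutive? x) q
sum-bonds-insertAt x []       = refl
sum-bonds-insertAt x (y ∷ ys) = begin
  (u + (h + b)) + sum (tabulate (λ i → hᵢ i + bᵢ i))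
    ≡⟨ cong (u + (h + b) +_) (sum-tabulate-+ hᵢ bᵢ) ⟩
  (u + (h + b)) + (sum (tabulate hᵢ) + sum (tabulate bᵢ))
    ≡⟨ cong₂ (λ s t → (u + (h + b)) + (s + t)) (sum-bondHead-insertAt x y ys) (sum-bonds-insertAt x ys) ⟩
  (u + (h + b)) + ((indicator (consecutive? y x) + L * h) + (L * b + 2 * c))
    ≡⟨ cong (λ u′ → (u + (h + b)) + ((u′ + L * h) + (L * b + 2 * c))) (indicator-consecutive-sym y x) ⟩
  (u + (h + b)) + ((u + L * h) + (L * b + 2 * c))
    ≡⟨ regroup u h b L c ⟩
  suc L * (h + b) + 2 * (u + c) ∎
  where
  open ≡-Reasoning
  hᵢ bᵢ : Fin (suc (length ys)) → ℕ
  hᵢ i = bondHead y (insertAt ys i x)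
  bᵢ i = bonds (insertAt ys i x)
  u = indicator (consecutive? x y)
  h = bondHead y ys
  b = bonds ys
  L = length ys
  c = count (consecutive? x) ys
  regroup : ∀ u h b L c → (u + (h + b)) + ((u + L * h) + (L * b + 2 * c)) ≡ suc L * (h + b) + 2 * (u + c)
  regroup = solve-∀

insertAt-↭ : ∀ {A : Set} (ys : List A) i x → insertAt ys i x ↭ x ∷ ys
insertAt-↭ ys       zero    x = ↭.refl
insertAt-↭ (y ∷ ys) (suc i) x = ↭.trans (↭.prep y (insertAt-↭ ys i x)) (↭.swap y x ↭.refl)

-- Weaker than being a permutation of 1, …, n, but all that the counting uses.
record Distinct≤ (n : ℕ) (q : List ℕ) : Set where
  field
    unique  : Unique q
    length≡ : length q ≡ n
    bounded : All (_≤ n) q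

Distinct≤-insertAt : ∀ {n q} → Distinct≤ n q → (i : Fin (suc (length q))) →
  Distinct≤ (suc n) (insertAt q i (suc n))
Distinct≤-insertAt {n} {q} dq i = record
  { unique  = Unique-resp-↭ (↭⇒↭ₛ (↭-sym q↭)) (All.map (λ y≤n 1+n≡y → 1+n≰n (subst (_≤ n) (sym 1+n≡y) y≤n)) bounded
                                             ∷ unique)
  ; length≡ = trans (length-insertAt q i (suc n)) (cong suc length≡)
  ; bounded = All-resp-↭ (↭-sym q↭) (≤-refl ∷ All.map m≤n⇒m≤1+n bounded)
  }
  where
  open Distinct≤ dq
  q↭ = insertAt-↭ q i (suc n)

All-concatMap-insertions : ∀ {P Q : Pred (List ℕ) 0ℓ} {x qs} → All Q qs →
  (∀ {q} → Q q → ∀ i → P (insertAt q i x)) → All P (concatMap (insertions x) qs)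
All-concatMap-insertions Qqs P-insertAt = concat⁺ (map⁺ (All.map (λ Qq → map⁺ (tabulate⁺ (P-insertAt Qq))) Qqs))

S-distinct≤ : ∀ n → All (Distinct≤ n) (S n)
S-distinct≤ zero    = record { unique = []; length≡ = refl; bounded = [] } ∷ []
S-distinct≤ (suc n) = All-concatMap-insertions (S-distinct≤ n) Distinct≤-insertAt

S-max∈ : ∀ n → All (suc n ∈_) (S (suc n))
S-max∈ n = All-concatMap-insertions (S-distinct≤ n) λ {q} _ i →
  Any-resp-↭ (↭-sym (insertAt-↭ q i (suc n))) (here refl)

<⇒¬consecutive-suc : ∀ {y n} → y < n → ¬ Consecutive (suc n) y
<⇒¬consecutive-suc y<n (inj₁ refl)      = <-asym y<n (<-trans (n<1+n _) (n<1+n _))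
<⇒¬consecutive-suc y<n (inj₂ 1+y≡1+n) = <-irrefl (suc-injective 1+y≡1+n) y<n

count-consecutive-suc-< : ∀ {n ys} → All (_< n) ys → count (consecutive? (suc n)) ys ≡ 0
count-consecutive-suc-< []                       = refl
count-consecutive-suc-< {n} {y ∷ _} (y<n ∷ ys<n) =
  cong₂ _+_ (indicator-no (consecutive? (suc n) y) (<⇒¬consecutive-suc y<n)) (count-consecutive-suc-< ys<n)

count-consecutive-suc : ∀ {n q} → Unique q → All (_≤ n) q → n ∈ q → count (consecutive? (suc n)) q ≡ 1
count-consecutive-suc {n} (n≢ys ∷ _) (_ ∷ ys≤n) (here refl) =
  cong₂ _+_ (indicator-yes (consecutive? (suc n) n) (inj₂ refl))
            (count-consecutive-suc-< (All.zipWith (λ (y≤n , n≢y) → ≤∧≢⇒< y≤n (≢-sym n≢y)) (ys≤n , n≢ys)))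
count-consecutive-suc {n} {y ∷ _} (y≢ys ∷ !ys) (y≤n ∷ ys≤n) (there n∈ys) =
  cong₂ _+_ (indicator-no (consecutive? (suc n) y) (<⇒¬consecutive-suc (≤∧≢⇒< y≤n (All.lookup y≢ys n∈ys))))
            (count-consecutive-suc !ys ys≤n n∈ys)

length-insertions : ∀ x q → length (insertions x q) ≡ suc (length q)
length-insertions x q = trans (length-map (λ i → insertAt q i x) (allFin _)) (length-tabulate id)

sum-map-insertions : ∀ (f : List ℕ → ℕ) x q →
  sum (map f (insertions x q)) ≡ sum (tabulate (λ i → f (insertAt q i x)))
sum-map-insertions f x q = cong sum (trans (cong (map f) (map-tabulate id (λ i → insertAt q i x)))
                                           (map-tabulate (λ i → insertAt q i x) f))

length-S : ∀ n → length (S (suc n)) ≡ suc n * length (S n)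
length-S n = begin
  length (concatMap (insertions (suc n)) (S n))             ≡⟨ length-concatMap (insertions (suc n)) (S n) ⟩
  sum (map (length ∘ insertions (suc n)) (S n))             ≡⟨ sum-map-cong (All.map length-insertions≡ (S-distinct≤ n)) ⟩
  sum (map (λ _ → suc n) (S n))                             ≡⟨ sum-map-const (suc n) (S n) ⟩
  suc n * length (S n) ∎
  where
  open ≡-Reasoning
  length-insertions≡ : ∀ {q} → Distinct≤ n q → length (insertions (suc n) q) ≡ suc n
  length-insertions≡ {q} dq = trans (length-insertions (suc n) q) (cong suc (Distinct≤.length≡ dq))

sum-bonds-S-suc : ∀ m → let n = suc m in
  sum (map bonds (S (suc n))) ≡ n * sum (map bonds (S n)) + 2 * length (S n)
sum-bonds-S-suc m = begin
  sum (map bonds (concatMap (insertions (suc n)) (S n)))           ≡⟨ sum-map-concatMap (insertions (suc n)) bonds (S n) ⟩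
  sum (map (λ q → sum (map bonds (insertions (suc n) q))) (S n))
    ≡⟨ sum-map-cong (All.zipWith per-q (S-distinct≤ n , S-max∈ m)) ⟩
  sum (map (λ q → n * bonds q + 2) (S n))                          ≡⟨ sum-map-affine n 2 bonds (S n) ⟩
  n * sum (map bonds (S n)) + 2 * length (S n) ∎
  where
  open ≡-Reasoning
  n = suc m
  per-q : ∀ {q} → Distinct≤ n q × n ∈ q → sum (map bonds (insertions (suc n) q)) ≡ n * bonds q + 2
  per-q {q} (dq , n∈q) = begin
    sum (map bonds (insertions (suc n) q))                        ≡⟨ sum-map-insertions bonds (suc n) q ⟩
    sum (tabulate (λ i → bonds (insertAt q i (suc n))))           ≡⟨ sum-bonds-insertAt (suc n) q ⟩
    length q * bonds q + 2 * count (consecutive? (suc n)) q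
      ≡⟨ cong₂ (λ l c → l * bonds q + 2 * c) length≡ (count-consecutive-suc unique bounded n∈q) ⟩
    n * bonds q + 2 ∎
    where open Distinct≤ dq

sum-bonds-S : ∀ m → sum (map bonds (S (suc m))) ≡ 2 * m * length (S m)
sum-bonds-S zero    = refl
sum-bonds-S (suc m) = begin
  sum (map bonds (S (suc (suc m))))                           ≡⟨ sum-bonds-S-suc m ⟩
  suc m * sum (map bonds (S (suc m))) + 2 * length (S (suc m))  ≡⟨ cong₂ (λ b l → suc m * b + 2 * l) (sum-bonds-S m) (length-S m) ⟩
  suc m * (2 * m * L) + 2 * (suc m * L)                         ≡⟨ regroup m L ⟩
  2 * suc m * (suc m * L)                                       ≡⟨ cong (2 * suc m *_) (sym (length-S m)) ⟩
  2 * suc m * length (S (suc m)) ∎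
  where
  open ≡-Reasoning
  L = length (S m)
  regroup : ∀ m L → suc m * (2 * m * L) + 2 * (suc m * L) ≡ 2 * suc m * (suc m * L)
  regroup = solve-∀

totalD₁+sum-bonds : ∀ n → totalD₁ n + sum (map bonds (S n)) ≡ n * length (S n)
totalD₁+sum-bonds n = begin
  totalD₁ n + sum (map bonds (S n))                       ≡⟨ sum-map-+ (length ∘ D₁) bonds (S n) ⟨
  sum (map (λ p → length (D₁ p) + bonds p) (S n))         ≡⟨ sum-map-cong (All.map length-D₁+bonds≡n (S-distinct≤ n)) ⟩
  sum (map (λ _ → n) (S n))                               ≡⟨ sum-map-const n (S n) ⟩
  n * length (S n) ∎
  where
  open ≡-Reasoning
  length-D₁+bonds≡n : ∀ {p} → Distinct≤ n p → length (D₁ p) + bonds p ≡ n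
  length-D₁+bonds≡n dp = trans (length-D₁+bonds (Distinct≤.unique dp)) (Distinct≤.length≡ dp)

totalD₁-suc : ∀ m → totalD₁ (suc m) + 2 * m * length (S m) ≡ suc m * length (S (suc m))
totalD₁-suc m = trans (cong (totalD₁ (suc m) +_) (sym (sum-bonds-S m))) (totalD₁+sum-bonds (suc m))

proposition1 : (n : ℕ) (h : n ≥ 2) →
    (ℤ.+ totalD₁ n) / 1 ≡ ((ℤ.+ length (S n)) / 1) ℚ.* rhs n h
proposition1 n@(suc (suc k)) (s≤s (s≤s z≤n)) = cleared-denominator⇒≡ (totalD₁ n) (length (S n)) n (2 * suc k) (suc k) (begin
  totalD₁ n * n + length (S n) * (2 * suc k)    ≡⟨ cong (λ F → totalD₁ n * n + F * (2 * suc k)) (length-S (suc k)) ⟩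
  totalD₁ n * n + n * L * (2 * suc k)           ≡⟨ regroup (totalD₁ n) n L (suc k) ⟩
  (totalD₁ n + 2 * suc k * L) * n               ≡⟨ cong (_* n) (totalD₁-suc (suc k)) ⟩
  n * length (S n) * n                          ≡⟨ cong (_* n) (*-comm n (length (S n))) ⟩
  length (S n) * n * n ∎)
  where
  open ≡-Reasoning
  L = length (S (suc k))
  regroup : ∀ T n L m → T * n + n * L * (2 * m) ≡ (T + 2 * m * L) * n
  regroup = solve-∀
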